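{- Let $n\ge 1$ and let $\sigma$ be a signature of the complete graph $K_n$. If the frustration index satisfies $l(K_n,\sigma)\le (n-1)/2$, then $p_-'(K_n,\sigma)=l(K_n,\sigma)$.
   Context: $K_n$ is the simple complete graph on $n$ vertices; a signature is a map $\sigma:E(K_n)\to\{+,-\}$. A circle is a connected 2-regular subgraph; its sign is the product of its edge signs. A signed graph is balanced if all circles are positive. The frustration index $l(\Sigma)$ is the smallest number of edges whose deletion leaves a balanced signed graph. $p_-'(\Sigma)$ is the maximum number of pairwise edge-disjoint negative circles in $\Sigma$. -}

module Defs where

open import Data.Nat using (ℕ; zero; suc; _+_; _*_; _≤_)
open import Data.Nat.Properties using ()
open import Data.Fin using (Fin; _<?_)
open import Data.List using (List; map; allFin)
open import Data.Nat.ListAction using (sum)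
open import Data.Bool using (Bool; true; false; _∧_; if_then_else_)
open import Data.Product using (Σ; _×_; ∃; ∃-syntax; _,_)
open import Data.Sum using (_⊎_)
open import Relation.Nullary using (¬_)
open import Relation.Nullary.Decidable using (⌊_⌋)
open import Relation.Binary.PropositionalEquality using (_≡_; _≢_)

data Sign : Set where
  plus minus : Sign

isMinus : Sign → Bool
isMinus plus  = false
isMinus minus = true

-- Vertices of K_n are Fin n; every pair {i , j} with i ≢ j is an edge.
-- A signature of K_n: a symmetric assignment of signs to unordered pairs
-- (values on the diagonal are irrelevant and never used).
record Signature (n : ℕ) : Set where
  field
    sgn : Fin n → Fin n → Sign
    sgn-sym : ∀ i j → sgn i j ≡ sgn j i
open Signature public

-- A set of edges of K_n (equivalently, a spanning subgraph of K_n):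
-- a symmetric, irreflexive Boolean relation on the vertices.
record EdgeSet (n : ℕ) : Set where
  field
    mem : Fin n → Fin n → Bool
    mem-sym : ∀ i j → mem i j ≡ mem j i
    mem-irr : ∀ i → mem i i ≡ false
open EdgeSet public

countPairs : {n : ℕ} → (Fin n → Fin n → Bool) → ℕ
countPairs {n} P =
  sum (map (λ i → sum (map (λ j → if ⌊ i <? j ⌋ ∧ P i j then 1 else 0) (allFin n))) (allFin n))

edgeCount : {n : ℕ} → EdgeSet n → ℕ
edgeCount S = countPairs (mem S)

degree : {n : ℕ} → EdgeSet n → Fin n → ℕ
degree {n} S v = sum (map (λ u → if mem S v u then 1 else 0) (allFin n))

data Walk {n : ℕ} (S : EdgeSet n) : Fin n → Fin n → Set where
  here : ∀ {u} → Walk S u u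
  step : ∀ {u w v} → mem S u w ≡ true → Walk S w v → Walk S u v

-- A circle: a nonempty, connected, 2-regular subgraph (given by its edge set;
-- its vertices are those of positive degree).
record IsCircle {n : ℕ} (C : EdgeSet n) : Set where
  field
    nonempty   : ∃[ i ] ∃[ j ] (mem C i j ≡ true)
    two-reg    : ∀ v → degree C v ≡ 0 ⊎ degree C v ≡ 2
    connected  : ∀ u v → degree C u ≢ 0 → degree C v ≢ 0 → Walk C u v

negCount : {n : ℕ} → Signature n → EdgeSet n → ℕ
negCount σ C = countPairs (λ i j → mem C i j ∧ isMinus (sgn σ i j))

data Even : ℕ → Set where
  ev0 : Even 0
  ev2 : ∀ {k} → Even k → Even (suc (suc k))

-- the sign of a circle is the product of its edge signs
IsPositive IsNegative : {n : ℕ} → Signature n → EdgeSet n → Set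
IsPositive σ C = Even (negCount σ C)
IsNegative σ C = ¬ Even (negCount σ C)

AvoidsEdges : {n : ℕ} → EdgeSet n → EdgeSet n → Set
AvoidsEdges C D = ∀ i j → mem C i j ≡ true → mem D i j ≡ false

BalancedAfterDeleting : {n : ℕ} → Signature n → EdgeSet n → Set
BalancedAfterDeleting σ D = ∀ C → IsCircle C → AvoidsEdges C D → IsPositive σ C

IsFrustrationIndex : {n : ℕ} → Signature n → ℕ → Set
IsFrustrationIndex σ l =
  (∃[ D ] (edgeCount D ≡ l × BalancedAfterDeleting σ D))
  × (∀ D → BalancedAfterDeleting σ D → l ≤ edgeCount D)

NegCirclePacking : {n : ℕ} → Signature n → (m : ℕ) → (Fin m → EdgeSet n) → Set
NegCirclePacking σ m F =
  (∀ a → IsCircle (F a) × IsNegative σ (F a))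
  × (∀ a b → a ≢ b → ∀ i j → mem (F a) i j ≡ true → mem (F b) i j ≡ false)

IsMaxNegCirclePacking : {n : ℕ} → Signature n → ℕ → Set
IsMaxNegCirclePacking σ p =
  (∃[ F ] NegCirclePacking σ p F)
  × (∀ m F → NegCirclePacking σ m F → m ≤ p)

-- Weak duality gives p ≤ l: a negative circle cannot avoid a balancing set D, so each circle
-- of a packing contains an edge of D, and edge-disjoint circles contain different ones.
--
-- For p ≥ l, the bound 2l < n provides a vertex r on no edge of a minimum balancing set D.
-- Switching at the vertices joined to r by a negative edge makes every edge at r positive;
-- then a triangle r i j with ij ∉ D avoids D, so ij is positive too.  Hence the edges that
-- are negative after switching lie in D, and since switching preserves the sign of every
-- circle they still balance the graph: there are exactly l of them.  Each of them, uv, is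
-- completed to a triangle uvw with two positive sides that is edge-disjoint from the
-- triangles already built.  The forbidden apices are u, v, the other two corners of each
-- built triangle through u or v, and the other end of each remaining negative edge at u or
-- v: at most 2l < n vertices.  The l triangles so obtained are negative.

module Submission where

open import Defs
open import Data.Nat using (ℕ; zero; suc; _+_; _*_; _∸_; _≤_; _<_; z≤n; s≤s; pred)
open import Data.Nat.Properties hiding (_≟_; _<?_)
open import Data.Nat.Solver using (module +-*-Solver)
open import Data.Nat.ListAction using (sum)
open import Data.Fin as Fin using (Fin; zero; suc; _≟_; _<?_)
import Data.Fin.Properties as Finₚ
open import Data.Bool using (Bool; true; false; _∧_; not; _xor_; if_then_else_; T)
open import Data.Unit using (tt)
open import Data.Bool.Properties using (∧-comm; ∧-zeroʳ; ∧-identityʳ; xor-comm; xor-same; ¬-not)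
open import Data.List
  using (List; []; _∷_; _++_; map; allFin; length; tabulate; filter; concatMap; cartesianProduct; lookup)
open import Data.List.Properties using (filter-++; length-++; length-map; ++-assoc; filter-notAll)
open import Data.List.Membership.Propositional using (_∈_; _∉_)
open import Data.List.Membership.Propositional.Properties
  using ( ∈-filter⁺; ∈-filter⁻; ∈-cartesianProduct⁺; ∈-allFin; ∈-concatMap⁺
        ; ∈-++⁺ˡ; ∈-++⁺ʳ; ∈-++⁻; ∈-map⁺; ∈-map⁻; ∈-lookup)
import Data.List.Membership.Setoid.Properties as Membershipₛ
open import Data.List.Relation.Unary.Any as Any using (Any; here; there)
open import Data.List.Relation.Unary.Unique.Propositional using (Unique)
import Data.List.Relation.Unary.Unique.Propositional.Properties as Uniqueₚ
open import Data.List.Relation.Unary.All as All using (All; []; _∷_)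
open import Data.List.Relation.Unary.All.Properties using (All¬⇒¬Any)
open import Data.List.Relation.Unary.AllPairs using (AllPairs; []; _∷_)
open import Data.Product using (Σ-syntax; _×_; _,_; proj₁; proj₂; ∃-syntax)
open import Data.Sum using (_⊎_; inj₁; inj₂; [_,_]′)
open import Data.Empty using (⊥; ⊥-elim)
open import Relation.Nullary using (¬_; Dec; yes; no; ¬?; _⊎-dec_)
open import Relation.Nullary.Decidable using (⌊_⌋; T?; decidable-stable)
open import Relation.Binary.Definitions using (tri<; tri≈; tri>)
open import Relation.Binary.PropositionalEquality
open import Function using (_∘_; _∘′_; _⇔_; mk⇔; Equivalence)
open import Algebra.Properties.Semiring.Sum +-*-semiring
  using (sum-syntax; sum-cong-≗; sum-replicate-zero; ∑-distrib-+; ∑-comm; *-distribˡ-sum)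

χ : Bool → ℕ
χ b = if b then 1 else 0

sum-map-tabulate : ∀ {n} {A : Set} (f : A → ℕ) (g : Fin n → A) →
                   sum (map f (tabulate g)) ≡ ∑[ i < n ] f (g i)
sum-map-tabulate {zero}  f g = refl
sum-map-tabulate {suc n} f g = cong (f (g zero) +_) (sum-map-tabulate f (g ∘′ suc))

sum-map-allFin : ∀ {n} (f : Fin n → ℕ) → sum (map f (allFin n)) ≡ ∑[ i < n ] f i
sum-map-allFin f = sum-map-tabulate f (λ i → i)

∑-zero : ∀ {n} {f : Fin n → ℕ} → (∀ i → f i ≡ 0) → ∑[ i < n ] f i ≡ 0
∑-zero {n} f≡0 = trans (sum-cong-≗ f≡0) (sum-replicate-zero n)

∑-point : ∀ {n} {f : Fin n → ℕ} (a : Fin n) → (∀ i → i ≢ a → f i ≡ 0) → ∑[ i < n ] f i ≡ f a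
∑-point {suc n} {f} zero    f≡0 = trans (cong (f zero +_) (∑-zero λ i → f≡0 (suc i) λ ())) (+-identityʳ _)
∑-point {suc n} {f} (suc a) f≡0 =
  cong₂ _+_ (f≡0 zero λ ()) (∑-point a λ i i≢a → f≡0 (suc i) (i≢a ∘ Finₚ.suc-injective))

∑-mono-≤ : ∀ {n} {f g : Fin n → ℕ} → (∀ i → f i ≤ g i) → ∑[ i < n ] f i ≤ ∑[ i < n ] g i
∑-mono-≤ {zero}  f≤g = z≤n
∑-mono-≤ {suc n} f≤g = +-mono-≤ (f≤g zero) (∑-mono-≤ (λ i → f≤g (suc i)))

even-+ : ∀ {a b} → Even a → Even b → Even (a + b)
even-+ ev0       eb = eb
even-+ (ev2 ea) eb = ev2 (even-+ ea eb)

even-+-cancelˡ : ∀ a {b} → Even a → Even (a + b) → Even b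
even-+-cancelˡ zero          _        eab      = eab
even-+-cancelˡ (suc (suc a)) (ev2 ea) (ev2 eab) = even-+-cancelˡ a ea eab

even-2* : ∀ a → Even (2 * a)
even-2* zero    = ev0
even-2* (suc a) = subst Even (sym (cong suc (+-suc a (a + 0)))) (ev2 (even-2* a))

even-χ : ∀ {b} → Even (χ b) → b ≡ false
even-χ {false} _ = refl

∑-even : ∀ {n} {f : Fin n → ℕ} → (∀ i → Even (f i)) → Even (∑[ i < n ] f i)
∑-even {zero}  _  = ev0
∑-even {suc n} ev = even-+ (ev zero) (∑-even (λ i → ev (suc i)))

∑∑ : ∀ {n} → (Fin n → Fin n → ℕ) → ℕ
∑∑ {n} w = ∑[ i < n ] ∑[ j < n ] w i j

∑∑-cong : ∀ {n} {v w : Fin n → Fin n → ℕ} → (∀ i j → v i j ≡ w i j) → ∑∑ v ≡ ∑∑ w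
∑∑-cong v≡w = sum-cong-≗ λ i → sum-cong-≗ (v≡w i)

∑∑-+ : ∀ {n} (v w : Fin n → Fin n → ℕ) → ∑∑ (λ i j → v i j + w i j) ≡ ∑∑ v + ∑∑ w
∑∑-+ {n} v w = trans (sum-cong-≗ {n} λ i → ∑-distrib-+ (v i) (w i)) (∑-distrib-+ {n} _ _)

∑∑-2* : ∀ {n} (w : Fin n → Fin n → ℕ) → ∑∑ (λ i j → 2 * w i j) ≡ 2 * ∑∑ w
∑∑-2* {n} w = sym (trans (*-distribˡ-sum {n} 2 _) (sum-cong-≗ {n} λ i → *-distribˡ-sum 2 (w i)))

∑∑-transpose : ∀ {n} (w : Fin n → Fin n → ℕ) → ∑∑ (λ i j → w j i) ≡ ∑∑ w
∑∑-transpose w = ∑-comm (λ i j → w j i)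

∑∑-point : ∀ {n} {w : Fin n → Fin n → ℕ} (a b : Fin n) →
           (∀ i j → ¬ (i ≡ a × j ≡ b) → w i j ≡ 0) → ∑∑ w ≡ w a b
∑∑-point a b w≡0 = trans (∑-point a λ i i≢a → ∑-zero λ j → w≡0 i j (i≢a ∘ proj₁))
                         (∑-point b λ j j≢b → w≡0 a j (j≢b ∘ proj₂))

∑∑-lift : ∀ {n} {a b c d : Fin n → Fin n → ℕ} → (∀ i j → a i j + b i j ≡ c i j + 2 * d i j) →
          ∑∑ a + ∑∑ b ≡ ∑∑ c + 2 * ∑∑ d
∑∑-lift {a = a} {b} {c} {d} pointwise = begin
  ∑∑ a + ∑∑ b                          ≡⟨ ∑∑-+ a b ⟨
  ∑∑ (λ i j → a i j + b i j)           ≡⟨ ∑∑-cong pointwise ⟩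
  ∑∑ (λ i j → c i j + 2 * d i j)       ≡⟨ ∑∑-+ c _ ⟩
  ∑∑ c + ∑∑ (λ i j → 2 * d i j)        ≡⟨ cong (∑∑ c +_) (∑∑-2* d) ⟩
  ∑∑ c + 2 * ∑∑ d                      ∎
  where open ≡-Reasoning

Relation : ℕ → Set
Relation n = Fin n → Fin n → Bool

Symmetric Irreflexive : ∀ {n} → Relation n → Set
Symmetric P   = ∀ i j → P i j ≡ P j i
Irreflexive P = ∀ i → P i i ≡ false

countTerm : ∀ {n} → Relation n → Fin n → Fin n → ℕ
countTerm P i j = χ (⌊ i <? j ⌋ ∧ P i j)

χ-sorted : ∀ {n} {i j : Fin n} → i Fin.< j → ∀ p → χ (⌊ i <? j ⌋ ∧ p) ≡ χ p
χ-sorted {i = i} {j} i<j p with i <? j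
... | yes _   = refl
... | no i≮j = ⊥-elim (i≮j i<j)

χ-unsorted : ∀ {n} {i j : Fin n} → ¬ i Fin.< j → ∀ p → χ (⌊ i <? j ⌋ ∧ p) ≡ 0
χ-unsorted {i = i} {j} i≮j p with i <? j
... | yes i<j = ⊥-elim (i≮j i<j)
... | no _    = refl

countPairs-∑∑ : ∀ {n} (P : Relation n) → countPairs P ≡ ∑∑ (countTerm P)
countPairs-∑∑ {n} P = trans (sum-map-allFin {n} _) (sum-cong-≗ {n} λ i → sum-map-allFin {n} _)

countPairs-mono : ∀ {n} {P Q : Relation n} → (∀ i j → P i j ≡ true → Q i j ≡ true) →
                  countPairs P ≤ countPairs Q
countPairs-mono {P = P} {Q} P⊆Q = subst₂ _≤_ (sym (countPairs-∑∑ P)) (sym (countPairs-∑∑ Q))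
  (∑-mono-≤ λ i → ∑-mono-≤ λ j → pointwise ⌊ i <? j ⌋ (P i j) (Q i j) (P⊆Q i j))
  where
  pointwise : ∀ b p q → (p ≡ true → q ≡ true) → χ (b ∧ p) ≤ χ (b ∧ q)
  pointwise false p     q _   = z≤n
  pointwise true  false q _   = z≤n
  pointwise true  true  q p⇒q rewrite p⇒q refl = s≤s z≤n

countPairs-lift : ∀ {n} {P Q R S : Relation n} →
                  (∀ i j → χ (P i j) + χ (Q i j) ≡ χ (R i j) + 2 * χ (S i j)) →
                  countPairs P + countPairs Q ≡ countPairs R + 2 * countPairs S
countPairs-lift {P = P} {Q} {R} {S} pointwise = begin
  countPairs P + countPairs Q
    ≡⟨ cong₂ _+_ (countPairs-∑∑ P) (countPairs-∑∑ Q) ⟩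
  ∑∑ (countTerm P) + ∑∑ (countTerm Q)
    ≡⟨ ∑∑-lift (λ i j → restrict ⌊ i <? j ⌋ (pointwise i j)) ⟩
  ∑∑ (countTerm R) + 2 * ∑∑ (countTerm S)
    ≡⟨ cong₂ (λ r s → r + 2 * s) (countPairs-∑∑ R) (countPairs-∑∑ S) ⟨
  countPairs R + 2 * countPairs S
    ∎
  where
  open ≡-Reasoning
  restrict : ∀ {p q r s} b → χ p + χ q ≡ χ r + 2 * χ s →
             χ (b ∧ p) + χ (b ∧ q) ≡ χ (b ∧ r) + 2 * χ (b ∧ s)
  restrict true  eq = eq
  restrict false _  = refl

∑∑-χ≡2*countPairs : ∀ {n} (P : Relation n) → Symmetric P → Irreflexive P →
                    ∑∑ (λ i j → χ (P i j)) ≡ 2 * countPairs P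
∑∑-χ≡2*countPairs P sym-P irr-P = begin
  ∑∑ (λ i j → χ (P i j))                           ≡⟨ ∑∑-cong split ⟩
  ∑∑ (λ i j → countTerm P i j + countTerm P j i)   ≡⟨ ∑∑-+ (countTerm P) _ ⟩
  ∑∑ (countTerm P) + ∑∑ (λ i j → countTerm P j i)  ≡⟨ cong (∑∑ (countTerm P) +_) (∑∑-transpose (countTerm P)) ⟩
  ∑∑ (countTerm P) + ∑∑ (countTerm P)              ≡⟨ cong (∑∑ (countTerm P) +_) (+-identityʳ _) ⟨
  2 * ∑∑ (countTerm P)                             ≡⟨ cong (2 *_) (countPairs-∑∑ P) ⟨
  2 * countPairs P                                 ∎
  where
  open ≡-Reasoning
  split : ∀ i j → χ (P i j) ≡ countTerm P i j + countTerm P j i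
  split i j with i <? j | j <? i
  ... | yes i<j | yes j<i = ⊥-elim (Finₚ.<-asym i<j j<i)
  ... | yes _   | no _    = sym (+-identityʳ _)
  ... | no _    | yes _   = cong χ (sym-P i j)
  ... | no i≮j  | no j≮i with Finₚ.<-cmp i j
  ...   | tri< i<j _ _ = ⊥-elim (i≮j i<j)
  ...   | tri≈ _ refl _ = cong χ (irr-P i)
  ...   | tri> _ _ j<i = ⊥-elim (j≮i j<i)

countPairs-false : ∀ {n} {P : Relation n} → (∀ i j → P i j ≡ false) → countPairs P ≡ 0
countPairs-false {n} {P} P≡false = trans (countPairs-∑∑ P) (∑-zero {n} λ i → ∑-zero {n} λ j →
  trans (cong (λ b → χ (⌊ i <? j ⌋ ∧ b)) (P≡false i j)) (cong χ (∧-zeroʳ _)))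

SupportedOn : ∀ {n} → Relation n → Fin n → Fin n → Set
SupportedOn P a b = ∀ i j → P i j ≡ true → (i ≡ a × j ≡ b) ⊎ (i ≡ b × j ≡ a)

countPairs-sortedPair : ∀ {n} (P : Relation n) {a b : Fin n} → a Fin.< b → SupportedOn P a b →
                        countPairs P ≡ χ (P a b)
countPairs-sortedPair P {a} {b} a<b support =
  trans (countPairs-∑∑ P) (trans (∑∑-point a b vanish) (χ-sorted a<b (P a b)))
  where
  vanish : ∀ i j → ¬ (i ≡ a × j ≡ b) → countTerm P i j ≡ 0
  vanish i j ≢ab with P i j in Pij
  ... | false = cong χ (∧-zeroʳ _)
  ... | true with support i j Pij
  ...   | inj₁ ≡ab           = ⊥-elim (≢ab ≡ab)
  ...   | inj₂ (refl , refl) = χ-unsorted (Finₚ.<-asym a<b) true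

countPairs-pair : ∀ {n} (P : Relation n) {a b : Fin n} → Symmetric P → a ≢ b → SupportedOn P a b →
                  countPairs P ≡ χ (P a b)
countPairs-pair P {a} {b} sym-P a≢b support with Finₚ.<-cmp a b
... | tri< a<b _ _ = countPairs-sortedPair P a<b support
... | tri≈ _ a≡b _ = ⊥-elim (a≢b a≡b)
... | tri> _ _ b<a = trans (countPairs-sortedPair P b<a swapped) (cong χ (sym-P b a))
  where
  swapped : SupportedOn P b a
  swapped i j Pij = Data.Sum.swap (support i j Pij)

mem⇒≢ : ∀ {n} (S : EdgeSet n) {i j} → mem S i j ≡ true → i ≢ j
mem⇒≢ S {i} Sij refl with () ← trans (sym Sij) (mem-irr S i)

Edge : ℕ → Set
Edge n = Fin n × Fin n

sortedIn : ∀ {n} → Relation n → Edge n → Bool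
sortedIn P (i , j) = ⌊ i <? j ⌋ ∧ P i j

edges : ∀ {n} → Relation n → List (Edge n)
edges {n} P = filter (T? ∘ sortedIn P) (cartesianProduct (allFin n) (allFin n))

length-filter-cartesianProduct : ∀ {A B : Set} (p : A × B → Bool) xs ys →
  length (filter (T? ∘ p) (cartesianProduct xs ys)) ≡ sum (map (λ x → sum (map (λ y → χ (p (x , y))) ys)) xs)
length-filter-cartesianProduct p []       ys = refl
length-filter-cartesianProduct p (x ∷ xs) ys = begin
  length (filter (T? ∘ p) (map (x ,_) ys ++ cartesianProduct xs ys))
    ≡⟨ cong length (filter-++ (T? ∘ p) (map (x ,_) ys) _) ⟩
  length (filter (T? ∘ p) (map (x ,_) ys) ++ filter (T? ∘ p) (cartesianProduct xs ys))
    ≡⟨ length-++ (filter (T? ∘ p) (map (x ,_) ys)) ⟩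
  length (filter (T? ∘ p) (map (x ,_) ys)) + length (filter (T? ∘ p) (cartesianProduct xs ys))
    ≡⟨ cong₂ _+_ (row ys) (length-filter-cartesianProduct p xs ys) ⟩
  _ ∎
  where
  open ≡-Reasoning
  row : ∀ ys → length (filter (T? ∘ p) (map (x ,_) ys)) ≡ sum (map (λ y → χ (p (x , y))) ys)
  row []       = refl
  row (y ∷ ys) with p (x , y)
  ... | true  = cong suc (row ys)
  ... | false = row ys

length-edges : ∀ {n} (P : Relation n) → length (edges P) ≡ countPairs P
length-edges {n} P = length-filter-cartesianProduct (sortedIn P) (allFin n) (allFin n)

edges-unique : ∀ {n} (P : Relation n) → Unique (edges P)
edges-unique {n} P =
  Uniqueₚ.filter⁺ (T? ∘ sortedIn P)
                  (Uniqueₚ.cartesianProduct⁺ (Uniqueₚ.allFin⁺ n) (Uniqueₚ.allFin⁺ n))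

∈-edges⁺ : ∀ {n} {P : Relation n} {i j} → i Fin.< j → P i j ≡ true → (i , j) ∈ edges P
∈-edges⁺ {P = P} {i} {j} i<j Pij =
  ∈-filter⁺ (T? ∘ sortedIn P) (∈-cartesianProduct⁺ (∈-allFin i) (∈-allFin j)) sorted
  where
  sorted : T (⌊ i <? j ⌋ ∧ P i j)
  sorted with i <? j
  ... | yes _   rewrite Pij = tt
  ... | no i≮j = i≮j i<j

∈-edges⁻ : ∀ {n} {P : Relation n} {i j} → (i , j) ∈ edges P → i Fin.< j × P i j ≡ true
∈-edges⁻ {n} {P} {i} {j} ij∈ =
  sorted (proj₂ (∈-filter⁻ (T? ∘ sortedIn P) {xs = cartesianProduct (allFin n) (allFin n)} ij∈))
  where
  sorted : T (⌊ i <? j ⌋ ∧ P i j) → i Fin.< j × P i j ≡ true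
  sorted t with i <? j | P i j
  ... | yes i<j | true = i<j , refl

∈-edges-sym : ∀ {n} {P : Relation n} {i j} → Symmetric P → i ≢ j → P i j ≡ true →
              (i , j) ∈ edges P ⊎ (j , i) ∈ edges P
∈-edges-sym {i = i} {j} sym-P i≢j Pij with Finₚ.<-cmp i j
... | tri< i<j _ _ = inj₁ (∈-edges⁺ i<j Pij)
... | tri≈ _ i≡j _ = ⊥-elim (i≢j i≡j)
... | tri> _ _ j<i = inj₂ (∈-edges⁺ j<i (trans (sym-P j i) Pij))

injection-into-list : ∀ {m} {A : Set} {xs : List A} (f : Fin m → A) →
                      (∀ a → f a ∈ xs) → (∀ {a b} → f a ≡ f b → a ≡ b) → m ≤ length xs
injection-into-list {A = A} f f∈ f-inj =
  Finₚ.injective⇒≤ λ {a} {b} eq → f-inj (Membershipₛ.index-injective (setoid A) (f∈ a) (f∈ b) eq)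

_∈?_ : ∀ {n} (a : Fin n) (vs : List (Fin n)) → Dec (a ∈ vs)
a ∈? vs = Any.any? (a ≟_) vs

missing-vertex : ∀ {n} (vs : List (Fin n)) → length vs < n → ∃[ w ] w ∉ vs
missing-vertex {n} vs |vs|<n with Finₚ.any? (λ w → ¬? (w ∈? vs))
... | yes w∉vs = w∉vs
... | no ∄w∉vs = ⊥-elim (<⇒≱ |vs|<n (injection-into-list (λ w → w) all∈ (λ eq → eq)))
  where
  all∈ : ∀ w → w ∈ vs
  all∈ w = decidable-stable (w ∈? vs) λ w∉vs → ∄w∉vs (w , w∉vs)

ends : ∀ {n} → Edge n → List (Fin n)
ends (i , j) = i ∷ j ∷ []

endpoints : ∀ {n} → List (Edge n) → List (Fin n)
endpoints = concatMap ends

length-endpoints : ∀ {n} (es : List (Edge n)) → length (endpoints es) ≡ 2 * length es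
length-endpoints []            = refl
length-endpoints ((i , j) ∷ es) = trans (cong (2 +_) (length-endpoints es)) (sym (*-suc 2 (length es)))

∈-endpoints : ∀ {n} {es : List (Edge n)} {e} {v} → e ∈ es → v ∈ ends e → v ∈ endpoints es
∈-endpoints e∈ v∈ = ∈-concatMap⁺ ends (Any.map (λ { refl → v∈ }) e∈)

unincident-vertex : ∀ {n} (D : EdgeSet n) → 2 * edgeCount D < n → ∃[ r ] (∀ v → mem D r v ≡ false)
unincident-vertex {n} D small with missing-vertex (endpoints (edges (mem D))) (subst (_< n) (sym length≡) small)
  where
  length≡ : length (endpoints (edges (mem D))) ≡ 2 * edgeCount D
  length≡ = trans (length-endpoints (edges (mem D))) (cong (2 *_) (length-edges (mem D)))
... | r , r∉ = r , λ v → ¬-not λ Drv → [ (λ rv∈ → r∉ (∈-endpoints rv∈ (here refl)))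
                                        , (λ vr∈ → r∉ (∈-endpoints vr∈ (there (here refl)))) ]′
                                        (∈-edges-sym (mem-sym D) (mem⇒≢ D Drv) Drv)

_∈ᵇ_ : ∀ {n} → Fin n → List (Fin n) → Bool
a ∈ᵇ vs = ⌊ a ∈? vs ⌋

∑-over-list : ∀ {n} (R : Fin n → Bool) (vs : List (Fin n)) → Unique vs →
              ∑[ u < n ] χ (R u ∧ u ∈ᵇ vs) ≡ sum (map (χ ∘ R) vs)
∑-over-list R []       _              = ∑-zero λ u → cong χ (∧-zeroʳ (R u))
∑-over-list {n} R (v ∷ vs) (v∉vs ∷ uniq) = begin
  ∑[ u < n ] χ (R u ∧ u ∈ᵇ (v ∷ vs))                          ≡⟨ sum-cong-≗ {n} split ⟩
  ∑[ u < n ] (χ (R u ∧ ⌊ u ≟ v ⌋) + χ (R u ∧ u ∈ᵇ vs))        ≡⟨ ∑-distrib-+ {n} _ _ ⟩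
  ∑[ u < n ] χ (R u ∧ ⌊ u ≟ v ⌋) + ∑[ u < n ] χ (R u ∧ u ∈ᵇ vs)
    ≡⟨ cong₂ _+_ (trans (∑-point v off-v) at-v) (∑-over-list R vs uniq) ⟩
  χ (R v) + sum (map (χ ∘ R) vs)                               ∎
  where
  open ≡-Reasoning
  split : ∀ u → χ (R u ∧ u ∈ᵇ (v ∷ vs)) ≡ χ (R u ∧ ⌊ u ≟ v ⌋) + χ (R u ∧ u ∈ᵇ vs)
  split u with R u | u ≟ v | u ∈? vs
  ... | false | _        | _        = refl
  ... | true  | no _     | no _     = refl
  ... | true  | no _     | yes _    = refl
  ... | true  | yes refl | no _     = refl
  ... | true  | yes refl | yes v∈vs = ⊥-elim (All¬⇒¬Any v∉vs v∈vs)
  off-v : ∀ u → u ≢ v → χ (R u ∧ ⌊ u ≟ v ⌋) ≡ 0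
  off-v u u≢v with u ≟ v
  ... | yes u≡v = ⊥-elim (u≢v u≡v)
  ... | no _    = cong χ (∧-zeroʳ (R u))
  at-v : χ (R v ∧ ⌊ v ≟ v ⌋) ≡ χ (R v)
  at-v with v ≟ v
  ... | yes _   = cong χ (∧-identityʳ (R v))
  ... | no v≢v = ⊥-elim (v≢v refl)

≟-sym : ∀ {n} (i j : Fin n) → ⌊ i ≟ j ⌋ ≡ ⌊ j ≟ i ⌋
≟-sym i j with i ≟ j | j ≟ i
... | yes _   | yes _   = refl
... | no _    | no _    = refl
... | yes i≡j | no j≢i = ⊥-elim (j≢i (sym i≡j))
... | no i≢j  | yes j≡i = ⊥-elim (i≢j (sym j≡i))

∧-true : ∀ {a b} → a ∧ b ≡ true → a ≡ true × b ≡ true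
∧-true {true} {true} _ = refl , refl

clique : ∀ {n} → List (Fin n) → EdgeSet n
clique vs = record
  { mem     = λ i j → (i ∈ᵇ vs ∧ not ⌊ i ≟ j ⌋) ∧ j ∈ᵇ vs
  ; mem-sym = λ i j → trans (cong (λ b → (i ∈ᵇ vs ∧ not b) ∧ j ∈ᵇ vs) (≟-sym i j))
                            (swap-ends (i ∈ᵇ vs) (j ∈ᵇ vs) (not ⌊ j ≟ i ⌋))
  ; mem-irr = irr
  }
  where
  swap-ends : ∀ a b c → (a ∧ c) ∧ b ≡ (b ∧ c) ∧ a
  swap-ends true  true  c     = refl
  swap-ends true  false true  = refl
  swap-ends true  false false = refl
  swap-ends false true  true  = refl
  swap-ends false true  false = refl
  swap-ends false false c     = refl
  irr : ∀ i → (i ∈ᵇ vs ∧ not ⌊ i ≟ i ⌋) ∧ i ∈ᵇ vs ≡ false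
  irr i with i ≟ i
  ... | yes _   = cong (_∧ i ∈ᵇ vs) (∧-zeroʳ (i ∈ᵇ vs))
  ... | no i≢i = ⊥-elim (i≢i refl)

clique-mem⁺ : ∀ {n} {vs : List (Fin n)} {i j} → i ∈ vs → j ∈ vs → i ≢ j → mem (clique vs) i j ≡ true
clique-mem⁺ {vs = vs} {i} {j} i∈ j∈ i≢j with i ∈? vs | j ∈? vs | i ≟ j
... | yes _  | yes _  | no _    = refl
... | no i∉ | _      | _       = ⊥-elim (i∉ i∈)
... | yes _  | no j∉ | _       = ⊥-elim (j∉ j∈)
... | yes _  | yes _  | yes i≡j = ⊥-elim (i≢j i≡j)

clique-mem⁻ : ∀ {n} {vs : List (Fin n)} {i j} → mem (clique vs) i j ≡ true → i ∈ vs × j ∈ vs × i ≢ j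
clique-mem⁻ {vs = vs} {i} {j} ij∈ with i ∈? vs | j ∈? vs | i ≟ j
... | yes i∈ | yes j∈ | no i≢j = i∈ , j∈ , i≢j

∈ᵇ-true : ∀ {n} {vs : List (Fin n)} {v} → v ∈ vs → v ∈ᵇ vs ≡ true
∈ᵇ-true {vs = vs} {v} v∈ with v ∈? vs
... | yes _  = refl
... | no v∉ = ⊥-elim (v∉ v∈)

degree-clique-∈ : ∀ {n} {vs : List (Fin n)} {v} → Unique vs → v ∈ vs →
                  degree (clique vs) v ≡ sum (map (λ u → χ (not ⌊ v ≟ u ⌋)) vs)
degree-clique-∈ {n} {vs} {v} uniq v∈ =
  trans (trans (sum-map-allFin {n} _) (∑-over-list _ vs uniq))
        (cong (λ b → sum (map (λ u → χ (b ∧ not ⌊ v ≟ u ⌋)) vs)) (∈ᵇ-true v∈))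

degree-clique-∉ : ∀ {n} {vs : List (Fin n)} {v} → v ∉ vs → degree (clique vs) v ≡ 0
degree-clique-∉ {n} {vs} {v} v∉ = trans (sum-map-allFin {n} _) (∑-zero vanish)
  where
  vanish : ∀ u → χ (mem (clique vs) v u) ≡ 0
  vanish u with v ∈? vs
  ... | yes v∈ = ⊥-elim (v∉ v∈)
  ... | no _   = refl

∈-of-degree≢0 : ∀ {n} {vs : List (Fin n)} {v} → degree (clique vs) v ≢ 0 → v ∈ vs
∈-of-degree≢0 {vs = vs} {v} deg≢0 = decidable-stable (v ∈? vs) (deg≢0 ∘ degree-clique-∉)

clique-walk : ∀ {n} {vs : List (Fin n)} {u v} → u ∈ vs → v ∈ vs → Walk (clique vs) u v
clique-walk {u = u} {v} u∈ v∈ with u ≟ v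
... | yes refl = here
... | no u≢v  = step (clique-mem⁺ u∈ v∈ u≢v) here

Triangle : ℕ → Set
Triangle n = Fin n × Fin n × Fin n

corners : ∀ {n} → Triangle n → List (Fin n)
corners (x , y , z) = x ∷ y ∷ z ∷ []

triangle : ∀ {n} → Triangle n → EdgeSet n
triangle t = clique (corners t)

triangle-degree : ∀ {n} {t : Triangle n} {v} → Unique (corners t) → v ∈ corners t →
                  degree (triangle t) v ≡ 2
triangle-degree {t = x , y , z} {v} uniq@((x≢y ∷ x≢z ∷ []) ∷ (y≢z ∷ []) ∷ [] ∷ []) v∈ =
  trans (degree-clique-∈ uniq v∈) (others v∈)
  where
  ≢-count : ∀ {a b} → a ≢ b → χ (not ⌊ a ≟ b ⌋) ≡ 1
  ≢-count {a} {b} a≢b with a ≟ b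
  ... | yes a≡b = ⊥-elim (a≢b a≡b)
  ... | no _    = refl
  ≡-count : ∀ a → χ (not ⌊ a ≟ a ⌋) ≡ 0
  ≡-count a with a ≟ a
  ... | yes _   = refl
  ... | no a≢a = ⊥-elim (a≢a refl)
  others : ∀ {v} → v ∈ corners (x , y , z) →
           χ (not ⌊ v ≟ x ⌋) + (χ (not ⌊ v ≟ y ⌋) + (χ (not ⌊ v ≟ z ⌋) + 0)) ≡ 2
  others (here refl)                 =
    cong₂ _+_ (≡-count x) (cong₂ _+_ (≢-count x≢y) (cong (_+ 0) (≢-count x≢z)))
  others (there (here refl))         =
    cong₂ _+_ (≢-count (x≢y ∘ sym)) (cong₂ _+_ (≡-count y) (cong (_+ 0) (≢-count y≢z)))
  others (there (there (here refl))) =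
    cong₂ _+_ (≢-count (x≢z ∘ sym)) (cong₂ _+_ (≢-count (y≢z ∘ sym)) (cong (_+ 0) (≡-count z)))

triangle-isCircle : ∀ {n} {t : Triangle n} → Unique (corners t) → IsCircle (triangle t)
triangle-isCircle {t = t@(x , y , z)} uniq@((x≢y ∷ _) ∷ _) = record
  { nonempty  = x , y , clique-mem⁺ (here refl) (there (here refl)) x≢y
  ; two-reg   = two-reg
  ; connected = λ u v u≢0 v≢0 → clique-walk (∈-of-degree≢0 u≢0) (∈-of-degree≢0 v≢0)
  }
  where
  two-reg : ∀ v → degree (triangle t) v ≡ 0 ⊎ degree (triangle t) v ≡ 2
  two-reg v = by-membership (v ∈? corners t)
    where
    by-membership : Dec (v ∈ corners t) → degree (triangle t) v ≡ 0 ⊎ degree (triangle t) v ≡ 2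
    by-membership (yes v∈) = inj₂ (triangle-degree uniq v∈)
    by-membership (no v∉)  = inj₁ (degree-clique-∉ v∉)

triangle-count : ∀ {n} (s : Relation n) {u v w : Fin n} → Symmetric s → Unique (corners (u , v , w)) →
                 s u w ≡ false → s v w ≡ false →
                 countPairs (λ i j → mem (triangle (u , v , w)) i j ∧ s i j) ≡ χ (s u v)
triangle-count s {u} {v} {w} sym-s uniq@((u≢v ∷ _) ∷ _) s-uw s-vw =
  trans (countPairs-pair P sym-P u≢v support) (cong (λ b → χ (b ∧ s u v)) uv∈)
  where
  P : Relation _
  P i j = mem (triangle (u , v , w)) i j ∧ s i j
  sym-P : Symmetric P
  sym-P i j = cong₂ _∧_ (mem-sym (triangle (u , v , w)) i j) (sym-s i j)
  uv∈ : mem (triangle (u , v , w)) u v ≡ true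
  uv∈ = clique-mem⁺ (here refl) (there (here refl)) u≢v
  absurd : true ≡ false → ⊥
  absurd ()
  pick : ∀ {i j} → i ∈ corners (u , v , w) → j ∈ corners (u , v , w) → i ≢ j → s i j ≡ true →
         (i ≡ u × j ≡ v) ⊎ (i ≡ v × j ≡ u)
  pick (here refl)                 (there (here refl))         _   _    = inj₁ (refl , refl)
  pick (there (here refl))         (here refl)                 _   _    = inj₂ (refl , refl)
  pick (here refl)                 (here refl)                 i≢j _    = ⊥-elim (i≢j refl)
  pick (there (here refl))         (there (here refl))         i≢j _    = ⊥-elim (i≢j refl)
  pick (there (there (here refl))) (there (there (here refl))) i≢j _    = ⊥-elim (i≢j refl)
  pick (here refl)                 (there (there (here refl))) _   s-ij = ⊥-elim (absurd (trans (sym s-ij) s-uw))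
  pick (there (there (here refl))) (here refl)                 _   s-ij =
    ⊥-elim (absurd (trans (sym s-ij) (trans (sym-s w u) s-uw)))
  pick (there (here refl))         (there (there (here refl))) _   s-ij = ⊥-elim (absurd (trans (sym s-ij) s-vw))
  pick (there (there (here refl))) (there (here refl))         _   s-ij =
    ⊥-elim (absurd (trans (sym s-ij) (trans (sym-s w v) s-vw)))
  pick (there (there (there ()))) _ _ _
  pick _ (there (there (there ()))) _ _
  support : SupportedOn P u v
  support i j Pij with ∧-true {mem (triangle (u , v , w)) i j} Pij
  ... | ij∈ , s-ij with clique-mem⁻ ij∈
  ...   | i∈ , j∈ , i≢j = pick i∈ j∈ i≢j s-ij

TwoRegular : ∀ {n} → EdgeSet n → Set
TwoRegular {n} C = ∀ v → degree C v ≡ 0 ⊎ degree C v ≡ 2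

marked-degree-sum-even : ∀ {n} (C : EdgeSet n) → TwoRegular C → (M : Fin n → Bool) →
                         Even (∑∑ (λ i j → χ (M i ∧ mem C i j)))
marked-degree-sum-even {n} C two-reg M = ∑-even row-even
  where
  row-even : ∀ i → Even (∑[ j < n ] χ (M i ∧ mem C i j))
  row-even i with M i | two-reg i
  ... | false | _         = subst Even (sym (∑-zero {n} λ _ → refl)) ev0
  ... | true  | inj₁ deg0 = subst Even (trans (sym deg0) (sum-map-allFin {n} _)) ev0
  ... | true  | inj₂ deg2 = subst Even (trans (sym deg2) (sum-map-allFin {n} _)) (ev2 ev0)

marked-degree-sum : ∀ {n} (C : EdgeSet n) (M : Fin n → Bool) →
                    ∑∑ (λ i j → χ (M i ∧ mem C i j))
                    ≡ countPairs (λ i j → mem C i j ∧ (M i xor M j))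
                      + 2 * countPairs (λ i j → (M i ∧ M j) ∧ mem C i j)
marked-degree-sum {n} C M = *-cancelˡ-≡ X _ 2 (begin
  2 * X                                             ≡⟨ cong (X +_) (+-identityʳ X) ⟩
  X + X                                             ≡⟨ cong (X +_) transposed ⟨
  X + ∑∑ (λ i j → χ (M j ∧ mem C i j))
    ≡⟨ ∑∑-lift (λ i j → pointwise (M i) (M j) (mem C i j)) ⟩
  ∑∑ (λ i j → χ (cut i j)) + 2 * ∑∑ (λ i j → χ (inside i j))
    ≡⟨ cong₂ (λ a b → a + 2 * b) (∑∑-χ≡2*countPairs cut sym-cut irr-cut)
                                 (∑∑-χ≡2*countPairs inside sym-inside irr-inside) ⟩
  2 * countPairs cut + 2 * (2 * countPairs inside)  ≡⟨ *-distribˡ-+ 2 (countPairs cut) _ ⟨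
  2 * (countPairs cut + 2 * countPairs inside)      ∎)
  where
  open ≡-Reasoning
  X : ℕ
  X = ∑∑ (λ i j → χ (M i ∧ mem C i j))
  cut inside : Relation n
  cut    i j = mem C i j ∧ (M i xor M j)
  inside i j = (M i ∧ M j) ∧ mem C i j
  pointwise : ∀ a b c → χ (a ∧ c) + χ (b ∧ c) ≡ χ (c ∧ (a xor b)) + 2 * χ ((a ∧ b) ∧ c)
  pointwise true  true  true  = refl
  pointwise true  false true  = refl
  pointwise false true  true  = refl
  pointwise false false true  = refl
  pointwise true  true  false = refl
  pointwise true  false false = refl
  pointwise false true  false = refl
  pointwise false false false = refl
  transposed : ∑∑ (λ i j → χ (M j ∧ mem C i j)) ≡ X
  transposed = trans (∑∑-cong λ i j → cong (λ b → χ (M j ∧ b)) (mem-sym C i j))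
                     (∑∑-transpose (λ i j → χ (M i ∧ mem C i j)))
  sym-cut : Symmetric cut
  sym-cut i j = cong₂ _∧_ (mem-sym C i j) (xor-comm (M i) (M j))
  irr-cut : Irreflexive cut
  irr-cut i = cong (_∧ (M i xor M i)) (mem-irr C i)
  sym-inside : Symmetric inside
  sym-inside i j = cong₂ _∧_ (∧-comm (M i) (M j)) (mem-sym C i j)
  irr-inside : Irreflexive inside
  irr-inside i = trans (cong ((M i ∧ M i) ∧_) (mem-irr C i)) (∧-zeroʳ _)

cut-even : ∀ {n} (C : EdgeSet n) → TwoRegular C → (M : Fin n → Bool) →
           Even (countPairs (λ i j → mem C i j ∧ (M i xor M j)))
cut-even C two-reg M =
  even-+-cancelˡ (2 * countPairs inside) (even-2* (countPairs inside))
    (subst Even (trans (marked-degree-sum C M) (+-comm (countPairs (λ i j → mem C i j ∧ (M i xor M j))) _))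
           (marked-degree-sum-even C two-reg M))
  where
  inside : Relation _
  inside i j = (M i ∧ M j) ∧ mem C i j

switch : ∀ {n} → (Fin n → Bool) → Relation n → Relation n
switch M s i j = s i j xor (M i xor M j)

switching-preserves-parity : ∀ {n} (C : EdgeSet n) → TwoRegular C → (M : Fin n → Bool) (s : Relation n) →
  Even (countPairs (λ i j → mem C i j ∧ s i j)) ⇔ Even (countPairs (λ i j → mem C i j ∧ switch M s i j))
switching-preserves-parity {n} C two-reg M s =
  mk⇔ (λ even-s  → even-+-cancelˡ (count s) even-s total-even)
      (λ even-s′ → even-+-cancelˡ (count (switch M s)) even-s′ (subst Even (+-comm (count s) _) total-even))
  where
  count : Relation n → ℕ
  count r = countPairs (λ i j → mem C i j ∧ r i j)
  pointwise : ∀ c s m → χ (c ∧ s) + χ (c ∧ (s xor m)) ≡ χ (c ∧ m) + 2 * χ (c ∧ (s ∧ not m))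
  pointwise false s     m     = refl
  pointwise true  true  true  = refl
  pointwise true  true  false = refl
  pointwise true  false true  = refl
  pointwise true  false false = refl
  total-even : Even (count s + count (switch M s))
  total-even = subst Even (sym (countPairs-lift {S = λ i j → mem C i j ∧ (s i j ∧ not (M i xor M j))}
                                                  λ i j → pointwise (mem C i j) (s i j) (M i xor M j)))
                      (even-+ (cut-even C two-reg M) (even-2* (count (λ i j → s i j ∧ not (M i xor M j)))))

common : ∀ {n} → EdgeSet n → EdgeSet n → Relation n
common C D i j = mem C i j ∧ mem D i j

avoids-or-meets : ∀ {n} (C D : EdgeSet n) →
                  AvoidsEdges C D ⊎ ∃[ e ] (e ∈ edges (mem D) × mem C (proj₁ e) (proj₂ e) ≡ true)
avoids-or-meets C D with edges (common C D) in common≡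
... | []          = inj₁ avoids
  where
  avoids : AvoidsEdges C D
  avoids i j Cij with mem D i j in Dij
  ... | false = refl
  ... | true with ∈-edges-sym (λ a b → cong₂ _∧_ (mem-sym C a b) (mem-sym D a b)) (mem⇒≢ C Cij)
                             (cong₂ _∧_ Cij Dij)
  ...   | inj₁ ij∈ with () ← subst ((i , j) ∈_) common≡ ij∈
  ...   | inj₂ ji∈ with () ← subst ((j , i) ∈_) common≡ ji∈
... | (i , j) ∷ _ with ∈-edges⁻ (subst ((i , j) ∈_) (sym common≡) (here refl))
...   | i<j , CDij = inj₂ ((i , j) , ∈-edges⁺ i<j (proj₂ (∧-true CDij)) , proj₁ (∧-true CDij))

packing≤balancing : ∀ {n} (σ : Signature n) (D : EdgeSet n) {m F} →
                    BalancedAfterDeleting σ D → NegCirclePacking σ m F → m ≤ edgeCount D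
packing≤balancing σ D {m} {F} D-bal (negative-circles , disjoint) =
  subst (m ≤_) (length-edges (mem D))
        (injection-into-list (proj₁ ∘ hit) (proj₁ ∘ proj₂ ∘ hit) hit-injective)
  where
  hit : ∀ a → ∃[ e ] (e ∈ edges (mem D) × mem (F a) (proj₁ e) (proj₂ e) ≡ true)
  hit a with avoids-or-meets (F a) D
  ... | inj₁ avoids = ⊥-elim (proj₂ (negative-circles a) (D-bal (F a) (proj₁ (negative-circles a)) avoids))
  ... | inj₂ meets  = meets
  hit-injective : ∀ {a b} → proj₁ (hit a) ≡ proj₁ (hit b) → a ≡ b
  hit-injective {a} {b} same with a ≟ b
  ... | yes a≡b = a≡b
  ... | no a≢b with () ← trans (sym (proj₂ (proj₂ (hit b))))
                              (disjoint a b a≢b _ _ (subst (λ e → mem (F a) (proj₁ e) (proj₂ e) ≡ true) same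
                                                          (proj₂ (proj₂ (hit a)))))

unique⇒∉-suffix : ∀ {A : Set} (ys : List A) {e zs} → Unique (ys ++ e ∷ zs) → e ∉ zs
unique⇒∉-suffix []       (e∉zs ∷ _) = All¬⇒¬Any e∉zs
unique⇒∉-suffix (_ ∷ ys) (_ ∷ uniq) = unique⇒∉-suffix ys uniq

linked : ∀ {n} → Fin n → Fin n → List (Fin n) → List (Fin n)
linked u v vs with (u ∈? vs) ⊎-dec (v ∈? vs)
... | yes _ = filter (λ w → ¬? ((w ≟ u) ⊎-dec (w ≟ v))) vs
... | no _  = []

∈-linked : ∀ {n} {u v w : Fin n} {vs} → w ∈ vs → w ≢ u → w ≢ v → u ∈ vs ⊎ v ∈ vs →
           w ∈ linked u v vs
∈-linked {u = u} {v} {w} {vs} w∈ w≢u w≢v uv∈ with (u ∈? vs) ⊎-dec (v ∈? vs)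
... | yes _   = ∈-filter⁺ (λ w → ¬? ((w ≟ u) ⊎-dec (w ≟ v))) w∈
                          λ { (inj₁ w≡u) → w≢u w≡u ; (inj₂ w≡v) → w≢v w≡v }
... | no ¬uv∈ = ⊥-elim (¬uv∈ uv∈)

length-linked : ∀ {n} (u v : Fin n) vs → length (linked u v vs) ≤ pred (length vs)
length-linked u v vs with (u ∈? vs) ⊎-dec (v ∈? vs)
... | no _          = z≤n
... | yes (inj₁ u∈) = <⇒≤pred (filter-notAll _ vs (Any.map (λ { refl ¬u → ¬u (inj₁ refl) }) u∈))
... | yes (inj₂ v∈) = <⇒≤pred (filter-notAll _ vs (Any.map (λ { refl ¬v → ¬v (inj₂ refl) }) v∈))

length-concatMap-linked : ∀ {n} {A : Set} (u v : Fin n) (f : A → List (Fin n)) {k} →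
                          (∀ x → length (f x) ≡ suc k) →
                          ∀ xs → length (concatMap (linked u v ∘ f) xs) ≤ k * length xs
length-concatMap-linked u v f {k} size []       = z≤n
length-concatMap-linked u v f {k} size (x ∷ xs) = begin
  length (linked u v (f x) ++ concatMap (linked u v ∘ f) xs)
    ≡⟨ length-++ (linked u v (f x)) ⟩
  length (linked u v (f x)) + length (concatMap (linked u v ∘ f) xs)
    ≤⟨ +-mono-≤ here-bound (length-concatMap-linked u v f size xs) ⟩
  k + k * length xs
    ≡⟨ *-suc k (length xs) ⟨
  k * length (x ∷ xs)
    ∎
  where
  open ≤-Reasoning
  here-bound : length (linked u v (f x)) ≤ k
  here-bound = subst (λ m → length (linked u v (f x)) ≤ pred m) (size x) (length-linked u v (f x))

AllPairs-lookup : ∀ {A : Set} {R : A → A → Set} {xs : List A} → (∀ {x y} → R x y → R y x) →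
                  AllPairs R xs → ∀ {a b} → a ≢ b → R (lookup xs a) (lookup xs b)
AllPairs-lookup R-sym (Rx ∷ _)  {zero}  {zero}  a≢b = ⊥-elim (a≢b refl)
AllPairs-lookup R-sym (Rx ∷ _)  {zero}  {suc b} _   = All.lookup Rx (∈-lookup b)
AllPairs-lookup R-sym (Rx ∷ _)  {suc a} {zero}  _   = R-sym (All.lookup Rx (∈-lookup a))
AllPairs-lookup R-sym (_ ∷ Rxs) {suc a} {suc b} a≢b = AllPairs-lookup R-sym Rxs (a≢b ∘ cong suc)

module TrianglePacking {n} (E : EdgeSet n) where

  es : List (Edge n)
  es = edges (mem E)

  base : Triangle n → Edge n
  base (u , v , _) = u , v

  data Based : Triangle n → Set where
    based : ∀ {u v w} → (u , v) ∈ es → mem E u w ≡ false → mem E v w ≡ false →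
            Unique (corners (u , v , w)) → Based (u , v , w)

  EdgeDisjoint : Triangle n → Triangle n → Set
  EdgeDisjoint t t′ = ∀ i j → mem (triangle t) i j ≡ true → mem (triangle t′) i j ≡ true → ⊥

  ends⊆corners : ∀ t {a} → a ∈ ends (base t) → a ∈ corners t
  ends⊆corners (x , y , z) (here refl)         = here refl
  ends⊆corners (x , y , z) (there (here refl)) = there (here refl)

  base-only : ∀ {t i j} → Based t → i ∈ corners t → j ∈ corners t → i Fin.< j → mem E i j ≡ true →
              (i , j) ≡ base t
  base-only (based uv∈ _ _ _) (here refl) (there (here refl)) _ _ = refl
  base-only (based uv∈ _ _ _) (there (here refl)) (here refl) v<u _ =
    ⊥-elim (Finₚ.<-asym v<u (proj₁ (∈-edges⁻ uv∈)))
  base-only _ (here refl)                 (here refl)                 i<i _ = ⊥-elim (Finₚ.<-irrefl refl i<i)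
  base-only _ (there (here refl))         (there (here refl))         i<i _ = ⊥-elim (Finₚ.<-irrefl refl i<i)
  base-only _ (there (there (here refl))) (there (there (here refl))) i<i _ = ⊥-elim (Finₚ.<-irrefl refl i<i)
  base-only (based _ Euw _ _) (here refl) (there (there (here refl))) _ Eij with () ← trans (sym Eij) Euw
  base-only (based _ _ Evw _) (there (here refl)) (there (there (here refl))) _ Eij with () ← trans (sym Eij) Evw
  base-only {u , _ , w} (based _ Euw _ _) (there (there (here refl))) (here refl) _ Eij
    with () ← trans (sym Eij) (trans (mem-sym E w u) Euw)
  base-only {_ , v , w} (based _ _ Evw _) (there (there (here refl))) (there (here refl)) _ Eij
    with () ← trans (sym Eij) (trans (mem-sym E w v) Evw)
  base-only _ (there (there (there ()))) _ _ _
  base-only _ _ (there (there (there ()))) _ _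

  edge-ends : ∀ {a b} → mem E a b ≡ true → ∃[ e ] (e ∈ es × a ∈ ends e × b ∈ ends e)
  edge-ends {a} {b} Eab with ∈-edges-sym (mem-sym E) (mem⇒≢ E Eab) Eab
  ... | inj₁ ab∈ = (a , b) , ab∈ , here refl , there (here refl)
  ... | inj₂ ba∈ = (b , a) , ba∈ , there (here refl) , here refl

  disjoint-if-apart : ∀ {u v w t} → (w ∈ corners t → u ∈ corners t ⊎ v ∈ corners t → ⊥) →
                      (u ∈ corners t → v ∈ corners t → ⊥) → EdgeDisjoint (u , v , w) t
  disjoint-if-apart {u} {v} {w} {t} w-apart uv-apart i j ij∈ ij∈t =
    shared (proj₁ new-ij) (proj₁ (proj₂ new-ij)) (proj₂ (proj₂ new-ij))
           (proj₁ old-ij) (proj₁ (proj₂ old-ij))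
    where
    new-ij : i ∈ corners (u , v , w) × j ∈ corners (u , v , w) × i ≢ j
    new-ij = clique-mem⁻ {vs = corners (u , v , w)} {i} {j} ij∈
    old-ij : i ∈ corners t × j ∈ corners t × i ≢ j
    old-ij = clique-mem⁻ {vs = corners t} {i} {j} ij∈t
    shared : ∀ {i j} → i ∈ corners (u , v , w) → j ∈ corners (u , v , w) → i ≢ j →
             i ∈ corners t → j ∈ corners t → ⊥
    shared (there (there (here refl))) (here refl)                 _   w∈ u∈ = w-apart w∈ (inj₁ u∈)
    shared (there (there (here refl))) (there (here refl))         _   w∈ v∈ = w-apart w∈ (inj₂ v∈)
    shared (here refl)                 (there (there (here refl))) _   u∈ w∈ = w-apart w∈ (inj₁ u∈)
    shared (there (here refl))         (there (there (here refl))) _   v∈ w∈ = w-apart w∈ (inj₂ v∈)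
    shared (here refl)                 (there (here refl))         _   u∈ v∈ = uv-apart u∈ v∈
    shared (there (here refl))         (here refl)                 _   v∈ u∈ = uv-apart u∈ v∈
    shared (here refl)                 (here refl)                 i≢j _  _  = i≢j refl
    shared (there (here refl))         (there (here refl))         i≢j _  _  = i≢j refl
    shared (there (there (here refl))) (there (there (here refl))) i≢j _  _  = i≢j refl
    shared (there (there (there ()))) _ _ _ _
    shared _ (there (there (there ()))) _ _ _

  -- T holds the triangles built on the edges after (u , v) in es, and ys the edges before it,
  -- which get their triangles afterwards.
  module Extend (ys : List (Edge n)) (u v : Fin n) (T : List (Triangle n))
                (split : ys ++ (u , v) ∷ map base T ≡ es) (small : 2 * length es < n) where

    uv∈es : (u , v) ∈ es
    uv∈es = subst ((u , v) ∈_) split (∈-++⁺ʳ ys (here refl))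

    u<v : u Fin.< v
    u<v = proj₁ (∈-edges⁻ uv∈es)

    uv∉bases : (u , v) ∉ map base T
    uv∉bases = unique⇒∉-suffix ys (subst Unique (sym split) (edges-unique (mem E)))

    length-es : length es ≡ length ys + suc (length T)
    length-es = begin
      length es                                  ≡⟨ cong length split ⟨
      length (ys ++ (u , v) ∷ map base T)        ≡⟨ length-++ ys ⟩
      length ys + suc (length (map base T))      ≡⟨ cong (λ m → length ys + suc m) (length-map base T) ⟩
      length ys + suc (length T)                 ∎
      where open ≡-Reasoning

    blocked : List (Fin n)
    blocked = u ∷ v ∷ concatMap (linked u v ∘ corners) T ++ concatMap (linked u v ∘ ends) ys

    few-blocked : length blocked < n
    few-blocked = begin-strict
      2 + length (concatMap (linked u v ∘ corners) T ++ concatMap (linked u v ∘ ends) ys)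
        ≡⟨ cong (2 +_) (length-++ (concatMap (linked u v ∘ corners) T)) ⟩
      2 + (length (concatMap (linked u v ∘ corners) T) + length (concatMap (linked u v ∘ ends) ys))
        ≤⟨ +-monoʳ-≤ 2 (+-mono-≤ (length-concatMap-linked u v corners (λ _ → refl) T)
                                 (length-concatMap-linked u v ends (λ _ → refl) ys)) ⟩
      2 + (2 * length T + 1 * length ys)
        ≤⟨ arithmetic (length T) (length ys) ⟩
      2 * (length ys + suc (length T))
        ≡⟨ cong (2 *_) length-es ⟨
      2 * length es
        <⟨ small ⟩
      n ∎
      where
      open ≤-Reasoning
      arithmetic : ∀ t y → 2 + (2 * t + 1 * y) ≤ 2 * (y + suc t)
      arithmetic t y = subst (2 + (2 * t + 1 * y) ≤_) (sym (identity t y)) (m≤m+n _ y)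
        where
        open +-*-Solver
        identity : ∀ t y → 2 * (y + suc t) ≡ 2 + (2 * t + 1 * y) + y
        identity = solve 2 (λ t y → con 2 :* (y :+ (con 1 :+ t)) := con 2 :+ (con 2 :* t :+ con 1 :* y) :+ y) refl

    apex : Fin n
    apex = proj₁ (missing-vertex blocked few-blocked)

    apex∉ : apex ∉ blocked
    apex∉ = proj₂ (missing-vertex blocked few-blocked)

    apex≢u : apex ≢ u
    apex≢u = apex∉ ∘ here

    apex≢v : apex ≢ v
    apex≢v = apex∉ ∘ there ∘ here

    apex-not-end : apex ∉ ends (u , v)
    apex-not-end (here w≡u)         = apex≢u w≡u
    apex-not-end (there (here w≡v)) = apex≢v w≡v

    apex-away-T : ∀ {t} → t ∈ T → apex ∈ corners t → u ∈ corners t ⊎ v ∈ corners t → ⊥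
    apex-away-T t∈ w∈ uv∈ = apex∉ (there (there (∈-++⁺ˡ
      (∈-concatMap⁺ (linked u v ∘ corners) (Any.map (λ { refl → ∈-linked w∈ apex≢u apex≢v uv∈ }) t∈)))))

    apex-away-ys : ∀ {e} → e ∈ ys → apex ∈ ends e → u ∈ ends e ⊎ v ∈ ends e → ⊥
    apex-away-ys e∈ w∈ uv∈ = apex∉ (there (there (∈-++⁺ʳ (concatMap (linked u v ∘ corners) T)
      (∈-concatMap⁺ (linked u v ∘ ends) (Any.map (λ { refl → ∈-linked w∈ apex≢u apex≢v uv∈ }) e∈)))))

    toward : ∀ {a} {vs : List (Fin n)} → a ≡ u ⊎ a ≡ v → a ∈ vs → u ∈ vs ⊎ v ∈ vs
    toward (inj₁ refl) = inj₁
    toward (inj₂ refl) = inj₂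

    sides-outside : ∀ {a} → a ≡ u ⊎ a ≡ v → mem E a apex ≡ false
    sides-outside {a} a∈uv = ¬-not λ Eaw → located (edge-ends Eaw)
      where
      located : ∃[ e ] (e ∈ es × a ∈ ends e × apex ∈ ends e) → ⊥
      located (e , e∈ , a∈ , w∈) with ∈-++⁻ ys (subst (e ∈_) (sym split) e∈)
      ... | inj₁ e∈ys                = apex-away-ys e∈ys w∈ (toward a∈uv a∈)
      ... | inj₂ (here refl)         = apex-not-end w∈
      ... | inj₂ (there e∈bases) with ∈-map⁻ base e∈bases
      ...   | t , t∈ , refl = apex-away-T t∈ (ends⊆corners t w∈) (toward a∈uv (ends⊆corners t a∈))

    new : Triangle n
    new = u , v , apex

    new-based : Based new
    new-based = based uv∈es (sides-outside (inj₁ refl)) (sides-outside (inj₂ refl))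
                      ((Finₚ.<⇒≢ u<v ∷ (apex≢u ∘ sym) ∷ []) ∷ ((apex≢v ∘ sym) ∷ []) ∷ [] ∷ [])

    base-new-not-old : ∀ {t} → t ∈ T → Based t → u ∈ corners t → v ∈ corners t → ⊥
    base-new-not-old t∈ t-based u∈ v∈ =
      uv∉bases (subst (_∈ map base T) (sym (base-only t-based u∈ v∈ u<v (proj₂ (∈-edges⁻ uv∈es))))
                       (∈-map⁺ base t∈))

    new-disjoint : ∀ {t} → t ∈ T → Based t → EdgeDisjoint new t
    new-disjoint {t} t∈ t-based =
      disjoint-if-apart {u} {v} {apex} {t} (apex-away-T t∈) (base-new-not-old t∈ t-based)

  Packing : List (Edge n) → Set
  Packing xs = Σ[ T ∈ List (Triangle n) ] (All Based T × AllPairs EdgeDisjoint T × map base T ≡ xs)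

  pack : ∀ ys xs → ys ++ xs ≡ es → 2 * length es < n → Packing xs
  pack ys []             _     _     = [] , [] , [] , refl
  pack ys ((u , v) ∷ xs) split small with pack (ys ++ (u , v) ∷ []) xs (trans (++-assoc ys _ xs) split) small
  ... | T , T-based , T-disjoint , refl =
    new ∷ T , new-based ∷ T-based
            , All.tabulate (λ t∈ → new-disjoint t∈ (All.lookup T-based t∈)) ∷ T-disjoint
            , refl
    where open Extend ys u v T split small

  triangle-packing : 2 * edgeCount E < n →
                     Σ[ T ∈ List (Triangle n) ] (All Based T × AllPairs EdgeDisjoint T × length T ≡ edgeCount E)
  triangle-packing small with pack [] es refl (subst (λ m → 2 * m < n) (sym (length-edges (mem E))) small)
  ... | T , T-based , T-disjoint , bases =
    T , T-based , T-disjoint , trans (sym (length-map base T)) (trans (cong length bases) (length-edges (mem E)))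

  Based⇒unique : ∀ {t} → Based t → Unique (corners t)
  Based⇒unique (based _ _ _ uniq) = uniq

module SwitchingAtRoot {n} (σ : Signature n) (r : Fin n) where

  negative : Relation n
  negative i j = isMinus (sgn σ i j)

  θ : Fin n → Bool
  θ v = not ⌊ v ≟ r ⌋ ∧ negative r v

  switched : Relation n
  switched = switch θ negative

  switched-sym : Symmetric switched
  switched-sym i j = cong₂ _xor_ (cong isMinus (sgn-sym σ i j)) (xor-comm (θ i) (θ j))

  switched-root : ∀ {v} → v ≢ r → switched r v ≡ false
  switched-root {v} v≢r with r ≟ r | v ≟ r
  ... | yes _   | no _    = xor-same (negative r v)
  ... | no r≢r | _       = ⊥-elim (r≢r refl)
  ... | _       | yes v≡r = ⊥-elim (v≢r v≡r)

  switched-root′ : ∀ {v} → v ≢ r → switched v r ≡ false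
  switched-root′ {v} v≢r = trans (switched-sym v r) (switched-root v≢r)

  sign-parity : ∀ {C} → IsCircle C →
                Even (negCount σ C) ⇔ Even (countPairs (λ i j → mem C i j ∧ switched i j))
  sign-parity {C} C-circle = switching-preserves-parity C (IsCircle.two-reg C-circle) θ negative

  frustrated : EdgeSet n
  frustrated = record
    { mem     = λ i j → not ⌊ i ≟ j ⌋ ∧ switched i j
    ; mem-sym = λ i j → cong₂ _∧_ (cong not (≟-sym i j)) (switched-sym i j)
    ; mem-irr = irr
    }
    where
    irr : ∀ i → not ⌊ i ≟ i ⌋ ∧ switched i i ≡ false
    irr i with i ≟ i
    ... | yes _   = refl
    ... | no i≢i = ⊥-elim (i≢i refl)

  frustrated-mem : ∀ {i j} → i ≢ j → mem frustrated i j ≡ switched i j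
  frustrated-mem {i} {j} i≢j with i ≟ j
  ... | yes i≡j = ⊥-elim (i≢j i≡j)
  ... | no _    = refl

  frustrated-balancing : BalancedAfterDeleting σ frustrated
  frustrated-balancing C C-circle avoids =
    Equivalence.from (sign-parity C-circle) (subst Even (sym (countPairs-false vanish)) ev0)
    where
    vanish : ∀ i j → mem C i j ∧ switched i j ≡ false
    vanish i j with mem C i j in Cij
    ... | false = refl
    ... | true  = trans (sym (frustrated-mem (mem⇒≢ C Cij))) (avoids i j Cij)

  negative-triangle : ∀ {u v w} → Unique (corners (u , v , w)) →
                      switched u v ≡ true → switched u w ≡ false → switched v w ≡ false →
                      IsNegative σ (triangle (u , v , w))
  negative-triangle uniq s-uv s-uw s-vw even
    with () ← subst Even (trans (triangle-count switched switched-sym uniq s-uw s-vw) (cong χ s-uv))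
                         (Equivalence.to (sign-parity (triangle-isCircle uniq)) even)

  module _ (D : EdgeSet n) (D-bal : BalancedAfterDeleting σ D) (r-free : ∀ v → mem D r v ≡ false) where

    switched-off-D : ∀ {i j} → i ≢ j → mem D i j ≡ false → switched i j ≡ false
    switched-off-D {i} {j} i≢j Dij = by-cases (i ≟ r) (j ≟ r)
      where
      by-cases : Dec (i ≡ r) → Dec (j ≡ r) → switched i j ≡ false
      by-cases (yes refl) _          = switched-root (i≢j ∘ sym)
      by-cases _          (yes refl) = switched-root′ i≢j
      by-cases (no i≢r)  (no j≢r)  =
        even-χ (subst Even (triangle-count switched switched-sym uniq
                                           (switched-root′ i≢r) (switched-root′ j≢r))
                           (Equivalence.to (sign-parity (triangle-isCircle uniq))
                                           (D-bal _ (triangle-isCircle uniq) avoids)))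
        where
        uniq : Unique (corners (i , j , r))
        uniq = (i≢j ∷ i≢r ∷ []) ∷ (j≢r ∷ []) ∷ [] ∷ []
        off-D : ∀ {a b} → a ∈ corners (i , j , r) → b ∈ corners (i , j , r) → a ≢ b →
                mem D a b ≡ false
        off-D (there (there (here refl))) _                           _   = r-free _
        off-D {a} _                      (there (there (here refl)))  _   = trans (mem-sym D a r) (r-free a)
        off-D (here refl)                (there (here refl))          _   = Dij
        off-D (there (here refl))        (here refl)                  _   = trans (mem-sym D j i) Dij
        off-D (here refl)                (here refl)                  a≢b = ⊥-elim (a≢b refl)
        off-D (there (here refl))        (there (here refl))          a≢b = ⊥-elim (a≢b refl)
        off-D (there (there (there ()))) _                            _
        off-D _                          (there (there (there ())))   _
        avoids : AvoidsEdges (triangle (i , j , r)) D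
        avoids a b ab∈ with clique-mem⁻ ab∈
        ... | a∈ , b∈ , a≢b = off-D a∈ b∈ a≢b

    frustrated⊆D : ∀ i j → mem frustrated i j ≡ true → mem D i j ≡ true
    frustrated⊆D i j ij∈ with mem D i j in Dij
    ... | true  = refl
    ... | false with () ← trans (sym ij∈) (trans (frustrated-mem (mem⇒≢ frustrated ij∈))
                                                (switched-off-D (mem⇒≢ frustrated ij∈) Dij))

  open TrianglePacking frustrated

  based-negative : ∀ {t} → Based t → IsNegative σ (triangle t)
  based-negative (based uv∈ Euw Evw uniq@((u≢v ∷ u≢w ∷ []) ∷ (v≢w ∷ []) ∷ [] ∷ [])) =
    negative-triangle uniq (trans (sym (frustrated-mem u≢v)) (proj₂ (∈-edges⁻ uv∈)))
                           (trans (sym (frustrated-mem u≢w)) Euw) (trans (sym (frustrated-mem v≢w)) Evw)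

  frustrated-packing : 2 * edgeCount frustrated < n → ∃[ F ] NegCirclePacking σ (edgeCount frustrated) F
  frustrated-packing small with triangle-packing small
  ... | ts , ts-based , ts-disjoint , |ts|≡ =
    subst (λ m → ∃[ F ] NegCirclePacking σ m F) |ts|≡ (triangle ∘ lookup ts , circles , disjoint)
    where
    circles : ∀ a → IsCircle (triangle (lookup ts a)) × IsNegative σ (triangle (lookup ts a))
    circles a = triangle-isCircle (Based⇒unique (All.lookup ts-based (∈-lookup a)))
              , based-negative (All.lookup ts-based (∈-lookup a))
    disjoint : ∀ a b → a ≢ b → ∀ i j →
               mem (triangle (lookup ts a)) i j ≡ true → mem (triangle (lookup ts b)) i j ≡ false
    disjoint a b a≢b i j ij∈a = ¬-not (AllPairs-lookup (λ d i j x y → d i j y x) ts-disjoint a≢b i j ij∈a)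

negative-triangle-packing : ∀ {n} (σ : Signature n) (D : EdgeSet n) {l} →
                            edgeCount D ≡ l → BalancedAfterDeleting σ D →
                            (∀ D′ → BalancedAfterDeleting σ D′ → l ≤ edgeCount D′) → 2 * l < n →
                            ∃[ F ] NegCirclePacking σ l F
negative-triangle-packing {n} σ D {l} |D|≡l D-bal D-min 2l<n
  with unincident-vertex D (subst (λ m → 2 * m < n) (sym |D|≡l) 2l<n)
... | r , r-free = subst (λ m → ∃[ F ] NegCirclePacking σ m F) |E|≡l
                         (frustrated-packing (subst (λ m → 2 * m < n) (sym |E|≡l) 2l<n))
  where
  open SwitchingAtRoot σ r
  |E|≡l : edgeCount frustrated ≡ l
  |E|≡l = ≤-antisym (subst (edgeCount frustrated ≤_) |D|≡l
                           (countPairs-mono {P = mem frustrated} {mem D} (frustrated⊆D D D-bal r-free)))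
                    (D-min frustrated frustrated-balancing)

mainTheorem6 : (n : ℕ) → 1 ≤ n → (σ : Signature n) → (l : ℕ)
    → IsFrustrationIndex σ l → 2 * l ≤ n ∸ 1
    → IsMaxNegCirclePacking σ l
mainTheorem6 (suc k) _ σ l ((D , |D|≡l , D-bal) , D-min) 2l≤k =
  negative-triangle-packing σ D |D|≡l D-bal D-min (s≤s 2l≤k) ,
  λ m F packing → subst (m ≤_) |D|≡l (packing≤balancing σ D D-bal packing)
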